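{- For all finite multisets $\Gamma,\Delta$ of formulas: $\Gamma\Rightarrow\Delta$ is derivable in $\mathsf{GWF_N}$ if and only if $\vdash_{\mathsf{WF_N}}\bigwedge\Gamma\rightarrow\bigvee\Delta$.
   Context: Formulas are built from a countable set of propositional atoms and $\bot$ using $\wedge,\vee,\rightarrow$; $A\leftrightarrow B$ abbreviates $(A\rightarrow B)\wedge(B\rightarrow A)$. $\bigwedge\Gamma$, $\bigvee\Delta$ are the conjunction/disjunction of the formulas of the multiset (empty conjunction read as $\bot\rightarrow\bot$, empty disjunction as $\bot$). Sequent calculus $\mathsf{GWF_N}$ (sequents $\Gamma\Rightarrow\Delta$, finite multisets, $p$ atomic): (Ax) $p,\Gamma\Rightarrow\Delta,p$; ($\bot_L$) $\bot,\Gamma\Rightarrow\Delta$; ($\wedge_L$) from $A,B,\Gamma\Rightarrow\Delta$ infer $A\wedge B,\Gamma\Rightarrow\Delta$; ($\wedge_R$) from $\Gamma\Rightarrow\Delta,A$ and $\Gamma\Rightarrow\Delta,B$ infer $\Gamma\Rightarrow\Delta,A\wedge B$; ($\vee_L$) from $A,\Gamma\Rightarrow\Delta$ and $B,\Gamma\Rightarrow\Delta$ infer $A\vee B,\Gamma\Rightarrow\Delta$; ($\vee_R$) from $\Gamma\Rightarrow\Delta,A,B$ infer $\Gamma\Rightarrow\Delta,A\vee B$; ($\rightarrow_R$) from $A\Rightarrow B$ infer $\Gamma\Rightarrow A\rightarrow B,\Delta$; ($\rightarrow_{LR_N}$) from $A\Rightarrow C,B$; $A,D\Rightarrow B$; $C\Rightarrow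 A,D$; $C,B\Rightarrow D$ infer $\Gamma,C\rightarrow D\Rightarrow A\rightarrow B,\Delta$. Hilbert system $\mathsf{WF}$: axioms all instances of $A\rightarrow(A\vee B)$; $B\rightarrow(A\vee B)$; $(A\wedge B)\rightarrow A$; $(A\wedge B)\rightarrow B$; $A\wedge(B\vee C)\rightarrow(A\wedge B)\vee(A\wedge C)$; $A\rightarrow A$; $\bot\rightarrow A$; rules: from $A$, $A\rightarrow B$ infer $B$; from $A$ infer $B\rightarrow A$; from $A\rightarrow B$, $B\rightarrow C$ infer $A\rightarrow C$; from $A\rightarrow B$, $A\rightarrow C$ infer $A\rightarrow(B\wedge C)$; from $A\rightarrow C$, $B\rightarrow C$ infer $(A\vee B)\rightarrow C$; from $A$, $B$ infer $A\wedge B$; from $A\leftrightarrow B$, $C\leftrightarrow D$ infer $(A\rightarrow C)\leftrightarrow(B\rightarrow D)$. $\mathsf{WF_N}$ is $\mathsf{WF}$ plus the rule (N): from $A\rightarrow B\vee C$, $C\rightarrow A\vee D$, $A\wedge D\rightarrow B$, $C\wedge B\rightarrow D$ infer $(A\rightarrow B)\leftrightarrow(C\rightarrow D)$. $\vdash_{\mathsf{WF_N}}A$ means $A$ is a theorem of $\mathsf{WF_N}$. -}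

module Defs where

open import Data.Nat using (ℕ)
open import Data.List using (List; []; _∷_; _++_; foldr)
open import Data.List.Relation.Binary.Permutation.Propositional using (_↭_)

data Fm : Set where
  atom : ℕ → Fm
  ⊥'   : Fm
  _∧'_ : Fm → Fm → Fm
  _∨'_ : Fm → Fm → Fm
  _⇒_  : Fm → Fm → Fm

infixr 6 _∧'_
infixr 5 _∨'_
infixr 4 _⇒_
infix 3 _⇔'_

_⇔'_ : Fm → Fm → Fm
A ⇔' B = (A ⇒ B) ∧' (B ⇒ A)

⋀ : List Fm → Fm
⋀ []       = ⊥' ⇒ ⊥'
⋀ (A ∷ []) = A
⋀ (A ∷ Γ@(_ ∷ _)) = A ∧' ⋀ Γ

⋁ : List Fm → Fm
⋁ []       = ⊥'
⋁ (A ∷ []) = A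
⋁ (A ∷ Δ@(_ ∷ _)) = A ∨' ⋁ Δ

-- Finite multisets are represented by lists; the rule
-- `perm` makes derivability invariant under reordering (i.e. it is a relation on
-- multisets).  Principal formulas are written at the head of the list.
infix 2 _⊢G_
data _⊢G_ : List Fm → List Fm → Set where
  perm : ∀ {Γ Γ' Δ Δ'} → Γ ↭ Γ' → Δ ↭ Δ' → Γ ⊢G Δ → Γ' ⊢G Δ'
  ax   : ∀ {p Γ Δ} → (atom p ∷ Γ) ⊢G (atom p ∷ Δ)
  ⊥L   : ∀ {Γ Δ} → (⊥' ∷ Γ) ⊢G Δ
  ∧L   : ∀ {A B Γ Δ} → (A ∷ B ∷ Γ) ⊢G Δ → ((A ∧' B) ∷ Γ) ⊢G Δ
  ∧R   : ∀ {A B Γ Δ} → Γ ⊢G (A ∷ Δ) → Γ ⊢G (B ∷ Δ) → Γ ⊢G ((A ∧' B) ∷ Δ)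
  ∨L   : ∀ {A B Γ Δ} → (A ∷ Γ) ⊢G Δ → (B ∷ Γ) ⊢G Δ → ((A ∨' B) ∷ Γ) ⊢G Δ
  ∨R   : ∀ {A B Γ Δ} → Γ ⊢G (A ∷ B ∷ Δ) → Γ ⊢G ((A ∨' B) ∷ Δ)
  ⇒R   : ∀ {A B Γ Δ} → (A ∷ []) ⊢G (B ∷ []) → Γ ⊢G ((A ⇒ B) ∷ Δ)
  ⇒LRN : ∀ {A B C D Γ Δ}
       → (A ∷ []) ⊢G (C ∷ B ∷ [])
       → (A ∷ D ∷ []) ⊢G (B ∷ [])
       → (C ∷ []) ⊢G (A ∷ D ∷ [])
       → (C ∷ B ∷ []) ⊢G (D ∷ [])
       → ((C ⇒ D) ∷ Γ) ⊢G ((A ⇒ B) ∷ Δ)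

data ⊢WFN : Fm → Set where
  ax∨₁  : ∀ {A B} → ⊢WFN (A ⇒ A ∨' B)
  ax∨₂  : ∀ {A B} → ⊢WFN (B ⇒ A ∨' B)
  ax∧₁  : ∀ {A B} → ⊢WFN (A ∧' B ⇒ A)
  ax∧₂  : ∀ {A B} → ⊢WFN (A ∧' B ⇒ B)
  axDis : ∀ {A B C} → ⊢WFN (A ∧' (B ∨' C) ⇒ (A ∧' B) ∨' (A ∧' C))
  axId  : ∀ {A} → ⊢WFN (A ⇒ A)
  ax⊥   : ∀ {A} → ⊢WFN (⊥' ⇒ A)
  mp    : ∀ {A B} → ⊢WFN A → ⊢WFN (A ⇒ B) → ⊢WFN B
  wk    : ∀ {A B} → ⊢WFN A → ⊢WFN (B ⇒ A)
  tr    : ∀ {A B C} → ⊢WFN (A ⇒ B) → ⊢WFN (B ⇒ C) → ⊢WFN (A ⇒ C)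
  ∧I⇒   : ∀ {A B C} → ⊢WFN (A ⇒ B) → ⊢WFN (A ⇒ C) → ⊢WFN (A ⇒ B ∧' C)
  ∨E⇒   : ∀ {A B C} → ⊢WFN (A ⇒ C) → ⊢WFN (B ⇒ C) → ⊢WFN (A ∨' B ⇒ C)
  ∧I    : ∀ {A B} → ⊢WFN A → ⊢WFN B → ⊢WFN (A ∧' B)
  cong⇒ : ∀ {A B C D} → ⊢WFN (A ⇔' B) → ⊢WFN (C ⇔' D)
        → ⊢WFN ((A ⇒ C) ⇔' (B ⇒ D))
  ruleN : ∀ {A B C D} → ⊢WFN (A ⇒ B ∨' C) → ⊢WFN (C ⇒ A ∨' D)
        → ⊢WFN (A ∧' D ⇒ B) → ⊢WFN (C ∧' B ⇒ D)
        → ⊢WFN ((A ⇒ B) ⇔' (C ⇒ D))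

{-# OPTIONS --safe #-}
module Submission where

-- Soundness is checked rule by rule, reading ⋀ and ⋁ as meets and joins for the
-- preorder X ≼ Y := ⊢ X → Y, in which ∧ and ∨ form a distributive lattice; the
-- premises of →LR_N are exactly the hypotheses of rule N.
--
-- Completeness goes through an auxiliary calculus Γ ⊩ Δ: decompose Γ ⇒ Δ completely
-- by the invertible rules for ∧, ∨ and ⊥, and require every resulting sequent of
-- atoms and implications to close by Ax, →R or →LR_N with ⊩-derivable premises.
-- Invertibility, weakening and contraction then hold by construction, and cut is
-- admissible by induction on the cut formula: when an implication is principal on
-- both sides, the two instances of →R or →LR_N compose using cuts on its immediate
-- subformulas only. So every theorem of WF_N is ⊩-derivable, and replaying the
-- decomposition with the rules of GWF_N turns ⊩ into ⊢G.

open import Defs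
open import Data.Nat using (ℕ)
open import Data.List using (List; []; _∷_; _++_; [_])
open import Data.List.Properties using (++-assoc; ++-identityʳ)
open import Data.List.Membership.Propositional using (_∈_)
open import Data.List.Membership.Propositional.Properties using (∈-++⁻)
open import Data.List.Relation.Unary.Any using (here; there)
open import Data.List.Relation.Binary.Subset.Propositional using (_⊆_)
open import Data.List.Relation.Binary.Subset.Propositional.Properties
  using (⊆-reflexive; ⊆-trans; ⊆-reflexive-↭; xs⊆xs++ys; xs⊆ys++xs)
open import Data.List.Relation.Binary.Permutation.Propositional
  using (_↭_; ↭-refl; ↭-sym; ↭-trans; ↭-reflexive; prep; swap)
open import Data.List.Relation.Binary.Permutation.Propositional.Properties
  using (shift; shifts; ∈-resp-↭)
open import Data.Product using (_×_; _,_; ∃; proj₂)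
open import Data.Sum using ([_,_]′)
open import Function using (id; _∘_)
open import Relation.Binary.PropositionalEquality using (refl; sym)

private variable
  A B C D E F X Y Z : Fm
  Γ Γ' Δ Δ' l l' r r' : List Fm
  p : ℕ

pattern ∈₀ = here refl
pattern ∈₁ = there ∈₀
pattern ∈₂ = there ∈₁

-- Soundness

infix 3 _≼_
_≼_ : Fm → Fm → Set
X ≼ Y = ⊢WFN (X ⇒ Y)

open import Relation.Binary.Reasoning.Base.Single _≼_ axId tr

⋀-lower : (Γ : List Fm) → X ∈ Γ → ⋀ Γ ≼ X
⋀-lower (A ∷ [])    ∈₀        = axId
⋀-lower (A ∷ B ∷ Γ) ∈₀        = ax∧₁
⋀-lower (A ∷ B ∷ Γ) (there m) = tr ax∧₂ (⋀-lower (B ∷ Γ) m)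

⋀-greatest : (Γ : List Fm) → (∀ {X} → X ∈ Γ → Z ≼ X) → Z ≼ ⋀ Γ
⋀-greatest []          h = wk axId
⋀-greatest (A ∷ [])    h = h ∈₀
⋀-greatest (A ∷ B ∷ Γ) h = ∧I⇒ (h ∈₀) (⋀-greatest (B ∷ Γ) (h ∘ there))

⋁-upper : (Δ : List Fm) → X ∈ Δ → X ≼ ⋁ Δ
⋁-upper (A ∷ [])    ∈₀        = axId
⋁-upper (A ∷ B ∷ Δ) ∈₀        = ax∨₁
⋁-upper (A ∷ B ∷ Δ) (there m) = tr (⋁-upper (B ∷ Δ) m) ax∨₂

⋁-least : (Δ : List Fm) → (∀ {X} → X ∈ Δ → X ≼ Z) → ⋁ Δ ≼ Z
⋁-least []          h = ax⊥
⋁-least (A ∷ [])    h = h ∈₀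
⋁-least (A ∷ B ∷ Δ) h = ∨E⇒ (h ∈₀) (⋁-least (B ∷ Δ) (h ∘ there))

⋀-antimono : Γ' ⊆ Γ → ⋀ Γ ≼ ⋀ Γ'
⋀-antimono {Γ'} {Γ} σ = ⋀-greatest Γ' (⋀-lower Γ ∘ σ)

⋁-mono : Δ ⊆ Δ' → ⋁ Δ ≼ ⋁ Δ'
⋁-mono {Δ} {Δ'} σ = ⋁-least Δ (⋁-upper Δ' ∘ σ)

⋀-uncons : (Γ : List Fm) → ⋀ (X ∷ Γ) ≼ X ∧' ⋀ Γ
⋀-uncons {X} Γ = ∧I⇒ (⋀-lower (X ∷ Γ) ∈₀) (⋀-antimono {Γ} {X ∷ Γ} there)

⋀-cons : (Γ : List Fm) → X ∧' ⋀ Γ ≼ ⋀ (X ∷ Γ)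
⋀-cons {X} Γ = ⋀-greatest (X ∷ Γ) λ { ∈₀ → ax∧₁ ; (there m) → tr ax∧₂ (⋀-lower Γ m) }

⋁-uncons : (Δ : List Fm) → ⋁ (X ∷ Δ) ≼ X ∨' ⋁ Δ
⋁-uncons {X} Δ = ⋁-least (X ∷ Δ) λ { ∈₀ → ax∨₁ ; (there m) → tr (⋁-upper Δ m) ax∨₂ }

⋁-cons : (Δ : List Fm) → X ∨' ⋁ Δ ≼ ⋁ (X ∷ Δ)
⋁-cons {X} Δ = ∨E⇒ (⋁-upper (X ∷ Δ) ∈₀) (⋁-mono {Δ} {X ∷ Δ} there)

∧-comm : X ∧' Y ≼ Y ∧' X
∧-comm = ∧I⇒ ax∧₂ ax∧₁

∨-comm : X ∨' Y ≼ Y ∨' X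
∨-comm = ∨E⇒ ax∨₂ ax∨₁

∨-distribʳ-∧ : (A ∨' C) ∧' (B ∨' C) ≼ (A ∧' B) ∨' C
∨-distribʳ-∧ {A} {C} {B} = begin
  (A ∨' C) ∧' (B ∨' C)                          ∼⟨ axDis ⟩
  ((A ∨' C) ∧' B) ∨' ((A ∨' C) ∧' C)            ∼⟨ ∨E⇒ (tr ∧-comm (tr axDis ax∨₁)) (tr ax∧₂ ax∨₂) ⟩
  ((B ∧' A) ∨' (B ∧' C)) ∨' C                   ∼⟨ ∨E⇒ (∨E⇒ (tr ∧-comm ax∨₁) (tr ax∧₂ ax∨₂)) ax∨₂ ⟩
  (A ∧' B) ∨' C                                 ∎

⊢G-sound : Γ ⊢G Δ → ⋀ Γ ≼ ⋁ Δ
⊢G-sound (perm σ τ d) = tr (⋀-antimono (∈-resp-↭ σ)) (tr (⊢G-sound d) (⋁-mono (∈-resp-↭ τ)))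
⊢G-sound (ax {p} {Γ} {Δ}) = tr (⋀-lower (atom p ∷ Γ) ∈₀) (⋁-upper (atom p ∷ Δ) ∈₀)
⊢G-sound (⊥L {Γ}) = tr (⋀-lower (⊥' ∷ Γ) ∈₀) ax⊥
⊢G-sound (∧L {A} {B} {Γ} d) = tr (⋀-greatest (A ∷ B ∷ Γ) components) (⊢G-sound d)
  where
    components : X ∈ A ∷ B ∷ Γ → ⋀ (A ∧' B ∷ Γ) ≼ X
    components ∈₀                = tr (⋀-lower (A ∧' B ∷ Γ) ∈₀) ax∧₁
    components ∈₁                = tr (⋀-lower (A ∧' B ∷ Γ) ∈₀) ax∧₂
    components (there (there m)) = ⋀-lower (A ∧' B ∷ Γ) (there m)
⊢G-sound (∨R {A} {B} {Γ} {Δ} d) = tr (⊢G-sound d) (⋁-least (A ∷ B ∷ Δ) components)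
  where
    components : X ∈ A ∷ B ∷ Δ → X ≼ ⋁ ((A ∨' B) ∷ Δ)
    components ∈₀                = tr ax∨₁ (⋁-upper ((A ∨' B) ∷ Δ) ∈₀)
    components ∈₁                = tr ax∨₂ (⋁-upper ((A ∨' B) ∷ Δ) ∈₀)
    components (there (there m)) = ⋁-upper ((A ∨' B) ∷ Δ) (there m)
⊢G-sound (∧R {A} {B} {Γ} {Δ} d e) = begin
  ⋀ Γ                         ∼⟨ ∧I⇒ (tr (⊢G-sound d) (⋁-uncons Δ)) (tr (⊢G-sound e) (⋁-uncons Δ)) ⟩
  (A ∨' ⋁ Δ) ∧' (B ∨' ⋁ Δ)    ∼⟨ ∨-distribʳ-∧ ⟩
  (A ∧' B) ∨' ⋁ Δ             ∼⟨ ⋁-cons Δ ⟩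
  ⋁ (A ∧' B ∷ Δ)              ∎
⊢G-sound (∨L {A} {B} {Γ} {Δ} d e) = begin
  ⋀ ((A ∨' B) ∷ Γ)            ∼⟨ tr (⋀-uncons Γ) ∧-comm ⟩
  ⋀ Γ ∧' (A ∨' B)             ∼⟨ axDis ⟩
  (⋀ Γ ∧' A) ∨' (⋀ Γ ∧' B)    ∼⟨ ∨E⇒ (tr ∧-comm (tr (⋀-cons Γ) (⊢G-sound d)))
                                      (tr ∧-comm (tr (⋀-cons Γ) (⊢G-sound e))) ⟩
  ⋁ Δ                         ∎
⊢G-sound (⇒R {A} {B} {Γ} {Δ} d) = tr (wk (⊢G-sound d)) (⋁-upper ((A ⇒ B) ∷ Δ) ∈₀)
⊢G-sound (⇒LRN {A} {B} {C} {D} {Γ} {Δ} d₁ d₂ d₃ d₄) = begin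
  ⋀ ((C ⇒ D) ∷ Γ)   ∼⟨ ⋀-lower ((C ⇒ D) ∷ Γ) ∈₀ ⟩
  C ⇒ D             ∼⟨ mp rule-N ax∧₂ ⟩
  A ⇒ B             ∼⟨ ⋁-upper ((A ⇒ B) ∷ Δ) ∈₀ ⟩
  ⋁ ((A ⇒ B) ∷ Δ)   ∎
  where
    rule-N : ⊢WFN ((A ⇒ B) ⇔' (C ⇒ D))
    rule-N = ruleN (tr (⊢G-sound d₁) ∨-comm) (⊢G-sound d₃) (⊢G-sound d₂) (⊢G-sound d₄)

-- The auxiliary calculus

infixr 5 _∷_
data Concat {I O : Set} (R : I → List O → Set) : List I → List O → Set where
  []  : Concat R [] []
  _∷_ : ∀ {x xs ys zs} → R x ys → Concat R xs zs → Concat R (x ∷ xs) (ys ++ zs)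

module _ {I O : Set} {R : I → List O → Set} where

  Concat-∈ : ∀ {x xs zs} → Concat R xs zs → x ∈ xs → ∃ λ ys → R x ys × ys ⊆ zs
  Concat-∈ (_∷_ {ys = ys} {zs} rx _) ∈₀ = ys , rx , xs⊆xs++ys ys zs
  Concat-∈ (_∷_ {ys = ys} {zs} _ rxs) (there m) =
    let (ws , rw , ws⊆zs) = Concat-∈ rxs m in ws , rw , ⊆-trans ws⊆zs (xs⊆ys++xs zs ys)

  Concat-restrict : ∀ {xs xs' zs'} → xs ⊆ xs' → Concat R xs' zs' →
                    ∃ λ zs → Concat R xs zs × zs ⊆ zs'
  Concat-restrict {[]}     _ _ = [] , [] , λ ()
  Concat-restrict {x ∷ xs} σ c =
    let (ys , rx , ys⊆) = Concat-∈ c (σ ∈₀)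
        (zs , rxs , zs⊆) = Concat-restrict (σ ∘ there) c
    in ys ++ zs , rx ∷ rxs , [ ys⊆ , zs⊆ ]′ ∘ ∈-++⁻ ys

module _ {T : Set} {R : T → List T → Set} {P : List T → Set}
         (P-resp-↭ : ∀ {xs ys} → xs ↭ ys → P xs → P ys)
         (step : ∀ {x ys} → (∀ {zs} → R x zs → P (zs ++ ys)) → P (x ∷ ys)) where

  Concat-elim-++ : ∀ xs {ys} → (∀ {zs} → Concat R xs zs → P (zs ++ ys)) → P (xs ++ ys)
  Concat-elim-++ []       h = h []
  Concat-elim-++ (x ∷ xs) {ys} h = step λ {zx} rx → P-resp-↭ (shifts xs zx)
    (Concat-elim-++ xs λ {zs} c → P-resp-↭ (↭-trans (↭-reflexive (++-assoc zx zs ys)) (shifts zx zs))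
      (h (rx ∷ c)))

  Concat-elim : ∀ xs → (∀ {zs} → Concat R xs zs → P zs) → P xs
  Concat-elim xs h = P-resp-↭ (↭-reflexive (++-identityʳ xs))
    (Concat-elim-++ xs λ {zs} c → P-resp-↭ (↭-reflexive (sym (++-identityʳ zs))) (h c))

∈⇒↭-cons : ∀ {T : Set} {x : T} {xs} → x ∈ xs → ∃ λ ys → x ∷ ys ↭ xs
∈⇒↭-cons {xs = _ ∷ ys} ∈₀ = ys , ↭-refl
∈⇒↭-cons {x = x} {y ∷ _} (there m) =
  let (ys , σ) = ∈⇒↭-cons m in y ∷ ys , ↭-trans (swap x y ↭-refl) (prep y σ)

-- LeftBranch x l: l lists the atoms and implications at one leaf of the
-- decomposition of x by ∧L and ∨L (⊥ has no leaf, ⊥L closes it); RightBranch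
-- dually uses ∧R and ∨R, and ⊥ leaves nothing on the right.
data LeftBranch : Fm → List Fm → Set where
  atomˡ : LeftBranch (atom p) [ atom p ]
  ⇒ˡ    : LeftBranch (A ⇒ B) [ A ⇒ B ]
  ∧ˡ    : LeftBranch A l → LeftBranch B l' → LeftBranch (A ∧' B) (l ++ l')
  ∨ˡ₁   : LeftBranch A l → LeftBranch (A ∨' B) l
  ∨ˡ₂   : LeftBranch B l → LeftBranch (A ∨' B) l

data RightBranch : Fm → List Fm → Set where
  atomʳ : RightBranch (atom p) [ atom p ]
  ⇒ʳ    : RightBranch (A ⇒ B) [ A ⇒ B ]
  ⊥ʳ    : RightBranch ⊥' []
  ∨ʳ    : RightBranch A r → RightBranch B r' → RightBranch (A ∨' B) (r ++ r')
  ∧ʳ₁   : RightBranch A r → RightBranch (A ∧' B) r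
  ∧ʳ₂   : RightBranch B r → RightBranch (A ∧' B) r

infix 2 _⊩_
data _⊩_ (Γ Δ : List Fm) : Set
data Closed (l r : List Fm) : Set
data NPremises (C D A B : Fm) : Set

data _⊩_ Γ Δ where
  byLeaves : (∀ {l r} → Concat LeftBranch Γ l → Concat RightBranch Δ r → Closed l r) → Γ ⊩ Δ

data Closed l r where
  byAx  : atom p ∈ l → atom p ∈ r → Closed l r
  by⇒R  : (A ⇒ B) ∈ r → [ A ] ⊩ [ B ] → Closed l r
  by⇒LR : (C ⇒ D) ∈ l → (A ⇒ B) ∈ r → NPremises C D A B → Closed l r

data NPremises C D A B where
  premises : [ A ] ⊩ C ∷ B ∷ [] → A ∷ D ∷ [] ⊩ [ B ] →
             [ C ] ⊩ A ∷ D ∷ [] → C ∷ B ∷ [] ⊩ [ D ] → NPremises C D A B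

NPremises-sym : NPremises C D A B → NPremises A B C D
NPremises-sym (premises d₁ d₂ d₃ d₄) = premises d₃ d₄ d₁ d₂

Closed-mono : l ⊆ l' → r ⊆ r' → Closed l r → Closed l' r'
Closed-mono σ τ (byAx m n)     = byAx (σ m) (τ n)
Closed-mono σ τ (by⇒R n d)     = by⇒R (τ n) d
Closed-mono σ τ (by⇒LR m n ps) = by⇒LR (σ m) (τ n) ps

⊩-mono : Γ ⊆ Γ' → Δ ⊆ Δ' → Γ ⊩ Δ → Γ' ⊩ Δ'
⊩-mono σ τ (byLeaves f) = byLeaves λ ls rs →
  let (_ , ls' , l⊆) = Concat-restrict σ ls
      (_ , rs' , r⊆) = Concat-restrict τ rs
  in Closed-mono l⊆ r⊆ (f ls' rs')

⊩-mono₁ : X ∈ Γ → Y ∈ Δ → [ X ] ⊩ [ Y ] → Γ ⊩ Δ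
⊩-mono₁ m n = ⊩-mono (λ { ∈₀ → m }) (λ { ∈₀ → n })

⊩-weakenˡ : Γ ⊩ Δ → X ∷ Γ ⊩ Δ
⊩-weakenˡ = ⊩-mono there id

⊩-weakenʳ : Γ ⊩ Δ → Γ ⊩ X ∷ Δ
⊩-weakenʳ = ⊩-mono id there

⊩-ax : atom p ∷ Γ ⊩ atom p ∷ Δ
⊩-ax = byLeaves λ { (atomˡ ∷ _) (atomʳ ∷ _) → byAx ∈₀ ∈₀ }

⊩-⇒ʳ : [ A ] ⊩ [ B ] → Γ ⊩ (A ⇒ B) ∷ Δ
⊩-⇒ʳ d = byLeaves λ { _ (⇒ʳ ∷ _) → by⇒R ∈₀ d }

⊩-⇒ʳ⁻ : [] ⊩ [ A ⇒ B ] → [ A ] ⊩ [ B ]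
⊩-⇒ʳ⁻ (byLeaves f) with f [] (⇒ʳ ∷ [])
... | by⇒R ∈₀ d = d

⊩-⇒LR : NPremises C D A B → (C ⇒ D) ∷ Γ ⊩ (A ⇒ B) ∷ Δ
⊩-⇒LR ps = byLeaves λ { (⇒ˡ ∷ _) (⇒ʳ ∷ _) → by⇒LR ∈₀ ∈₀ ps }

⊩-⊥ˡ : ⊥' ∷ Γ ⊩ Δ
⊩-⊥ˡ = byLeaves λ { (() ∷ _) _ }

⊩-⊥ʳ⁻ : Γ ⊩ ⊥' ∷ Δ → Γ ⊩ Δ
⊩-⊥ʳ⁻ (byLeaves f) = byLeaves λ ls rs → f ls (⊥ʳ ∷ rs)

⊩-∧ˡ : A ∷ B ∷ Γ ⊩ Δ → A ∧' B ∷ Γ ⊩ Δ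
⊩-∧ˡ (byLeaves f) = byLeaves λ { (∧ˡ {l = l₁} {l' = l₂} a b ∷ ls) rs →
  Closed-mono (⊆-reflexive (sym (++-assoc l₁ l₂ _))) id (f (a ∷ b ∷ ls) rs) }

⊩-∧ˡ⁻ : A ∧' B ∷ Γ ⊩ Δ → A ∷ B ∷ Γ ⊩ Δ
⊩-∧ˡ⁻ (byLeaves f) = byLeaves λ { (_∷_ {ys = l₁} a (_∷_ {ys = l₂} b ls)) rs →
  Closed-mono (⊆-reflexive (++-assoc l₁ l₂ _)) id (f (∧ˡ a b ∷ ls) rs) }

⊩-∨ˡ : A ∷ Γ ⊩ Δ → B ∷ Γ ⊩ Δ → (A ∨' B) ∷ Γ ⊩ Δ
⊩-∨ˡ (byLeaves f) (byLeaves g) = byLeaves λ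
  { (∨ˡ₁ a ∷ ls) rs → f (a ∷ ls) rs
  ; (∨ˡ₂ b ∷ ls) rs → g (b ∷ ls) rs }

⊩-∨ˡ⁻₁ : (A ∨' B) ∷ Γ ⊩ Δ → A ∷ Γ ⊩ Δ
⊩-∨ˡ⁻₁ (byLeaves f) = byLeaves λ { (a ∷ ls) rs → f (∨ˡ₁ a ∷ ls) rs }

⊩-∨ˡ⁻₂ : (A ∨' B) ∷ Γ ⊩ Δ → B ∷ Γ ⊩ Δ
⊩-∨ˡ⁻₂ (byLeaves f) = byLeaves λ { (b ∷ ls) rs → f (∨ˡ₂ b ∷ ls) rs }

⊩-∨ʳ : Γ ⊩ A ∷ B ∷ Δ → Γ ⊩ (A ∨' B) ∷ Δ
⊩-∨ʳ (byLeaves f) = byLeaves λ { ls (∨ʳ {r = r₁} {r' = r₂} a b ∷ rs) →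
  Closed-mono id (⊆-reflexive (sym (++-assoc r₁ r₂ _))) (f ls (a ∷ b ∷ rs)) }

⊩-∨ʳ⁻ : Γ ⊩ (A ∨' B) ∷ Δ → Γ ⊩ A ∷ B ∷ Δ
⊩-∨ʳ⁻ (byLeaves f) = byLeaves λ { ls (_∷_ {ys = r₁} a (_∷_ {ys = r₂} b rs)) →
  Closed-mono id (⊆-reflexive (++-assoc r₁ r₂ _)) (f ls (∨ʳ a b ∷ rs)) }

⊩-∧ʳ : Γ ⊩ A ∷ Δ → Γ ⊩ B ∷ Δ → Γ ⊩ A ∧' B ∷ Δ
⊩-∧ʳ (byLeaves f) (byLeaves g) = byLeaves λ
  { ls (∧ʳ₁ a ∷ rs) → f ls (a ∷ rs)
  ; ls (∧ʳ₂ b ∷ rs) → g ls (b ∷ rs) }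

⊩-∧ʳ⁻₁ : Γ ⊩ A ∧' B ∷ Δ → Γ ⊩ A ∷ Δ
⊩-∧ʳ⁻₁ (byLeaves f) = byLeaves λ { ls (a ∷ rs) → f ls (∧ʳ₁ a ∷ rs) }

⊩-∧ʳ⁻₂ : Γ ⊩ A ∧' B ∷ Δ → Γ ⊩ B ∷ Δ
⊩-∧ʳ⁻₂ (byLeaves f) = byLeaves λ { ls (b ∷ rs) → f ls (∧ʳ₂ b ∷ rs) }

-- Cut admissibility

CutAdmissible : Fm → Set
CutAdmissible X = ∀ {Γ Δ} → Γ ⊩ X ∷ Δ → X ∷ Γ ⊩ Δ → Γ ⊩ Δ

Closed-cut-atom : Closed l (atom p ∷ r) → Closed (atom p ∷ l) r → Closed l r
Closed-cut-atom (byAx m ∈₀)            c = Closed-mono (λ { ∈₀ → m ; (there k) → k }) id c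
Closed-cut-atom (byAx m (there n))     _ = byAx m n
Closed-cut-atom (by⇒R (there n) d)     _ = by⇒R n d
Closed-cut-atom (by⇒LR m (there n) ps) _ = by⇒LR m n ps

module _ {A B : Fm} (cutA : CutAdmissible A) (cutB : CutAdmissible B) where

  ⇒R-cut-⇒LR : [ A ] ⊩ [ B ] → NPremises A B E F → [ E ] ⊩ [ F ]
  ⇒R-cut-⇒LR d (premises e₁ e₂ _ _) =
    cutA e₁ (cutB (⊩-mono₁ ∈₀ ∈₀ d) (⊩-mono (λ { ∈₀ → ∈₂ ; ∈₁ → ∈₀ }) id e₂))

  NPremises-trans : NPremises C D A B → NPremises A B E F → NPremises C D E F
  NPremises-trans (premises c₁ c₂ c₃ c₄) (premises e₁ e₂ e₃ e₄) = premises
    (cutA (⊩-mono id (λ { ∈₀ → ∈₀ ; ∈₁ → ∈₂ }) e₁)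
          (cutB (⊩-mono (λ { ∈₀ → ∈₀ }) (λ { ∈₀ → ∈₁ ; ∈₁ → ∈₀ }) c₁)
                (⊩-mono (λ { ∈₀ → ∈₂ ; ∈₁ → ∈₀ }) (λ { ∈₀ → ∈₁ }) e₂)))
    (cutA (⊩-mono (λ { ∈₀ → ∈₀ }) id e₁)
          (cutB (⊩-mono (λ { ∈₀ → ∈₀ ; ∈₁ → ∈₂ }) (λ { ∈₀ → ∈₀ }) c₂)
                (⊩-mono (λ { ∈₀ → ∈₂ ; ∈₁ → ∈₀ }) id e₂)))
    (cutA (⊩-mono id (λ { ∈₀ → ∈₀ ; ∈₁ → ∈₂ }) c₃)
          (cutB (⊩-mono (λ { ∈₀ → ∈₀ }) (λ { ∈₀ → ∈₁ ; ∈₁ → ∈₀ }) e₃)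
                (⊩-mono (λ { ∈₀ → ∈₂ ; ∈₁ → ∈₀ }) (λ { ∈₀ → ∈₁ }) c₄)))
    (cutA (⊩-mono (λ { ∈₀ → ∈₀ }) id c₃)
          (cutB (⊩-mono (λ { ∈₀ → ∈₀ ; ∈₁ → ∈₂ }) (λ { ∈₀ → ∈₀ }) e₄)
                (⊩-mono (λ { ∈₀ → ∈₂ ; ∈₁ → ∈₀ }) id c₄)))

  Closed-cut-⇒ʳ : [ A ] ⊩ [ B ] → Closed ((A ⇒ B) ∷ l) r → Closed l r
  Closed-cut-⇒ʳ _ (byAx (there m) n)     = byAx m n
  Closed-cut-⇒ʳ _ (by⇒R n e)             = by⇒R n e
  Closed-cut-⇒ʳ _ (by⇒LR (there m) n qs) = by⇒LR m n qs
  Closed-cut-⇒ʳ d (by⇒LR ∈₀ n qs)        = by⇒R n (⇒R-cut-⇒LR d qs)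

  Closed-cut-⇒LR : (C ⇒ D) ∈ l → NPremises C D A B → Closed ((A ⇒ B) ∷ l) r → Closed l r
  Closed-cut-⇒LR _ _  (byAx (there k) n)     = byAx k n
  Closed-cut-⇒LR _ _  (by⇒R n e)             = by⇒R n e
  Closed-cut-⇒LR _ _  (by⇒LR (there k) n qs) = by⇒LR k n qs
  Closed-cut-⇒LR m ps (by⇒LR ∈₀ n qs)        = by⇒LR m n (NPremises-trans ps qs)

  Closed-cut-⇒ : Closed l ((A ⇒ B) ∷ r) → Closed ((A ⇒ B) ∷ l) r → Closed l r
  Closed-cut-⇒ (byAx m (there n))     _ = byAx m n
  Closed-cut-⇒ (by⇒R (there n) d)     _ = by⇒R n d
  Closed-cut-⇒ (by⇒LR m (there n) ps) _ = by⇒LR m n ps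
  Closed-cut-⇒ (by⇒R ∈₀ d)            c = Closed-cut-⇒ʳ d c
  Closed-cut-⇒ (by⇒LR m ∈₀ ps)        c = Closed-cut-⇒LR m ps c

⊩-cut : (X : Fm) → CutAdmissible X
⊩-cut (atom p) (byLeaves f) (byLeaves g) =
  byLeaves λ ls rs → Closed-cut-atom (f ls (atomʳ ∷ rs)) (g (atomˡ ∷ ls) rs)
⊩-cut ⊥'       d _ = ⊩-⊥ʳ⁻ d
⊩-cut (A ∧' B) d e = ⊩-cut B (⊩-∧ʳ⁻₂ d) (⊩-cut A (⊩-weakenˡ (⊩-∧ʳ⁻₁ d)) (⊩-∧ˡ⁻ e))
⊩-cut (A ∨' B) d e = ⊩-cut B (⊩-cut A (⊩-∨ʳ⁻ d) (⊩-weakenʳ (⊩-∨ˡ⁻₁ e))) (⊩-∨ˡ⁻₂ e)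
⊩-cut (A ⇒ B) (byLeaves f) (byLeaves g) =
  byLeaves λ ls rs → Closed-cut-⇒ (⊩-cut A) (⊩-cut B) (f ls (⇒ʳ ∷ rs)) (g (⇒ˡ ∷ ls) rs)

⊩-trans : Γ ⊩ [ X ] → [ X ] ⊩ Δ → Γ ⊩ Δ
⊩-trans {X = X} {Δ = Δ} d e =
  ⊩-cut X (⊩-mono id (xs⊆xs++ys [ X ] Δ) d) (⊩-mono (xs⊆xs++ys [ X ] _) id e)

-- Completeness

NPremises-of-equiv : [ A ] ⊩ [ C ] → [ D ] ⊩ [ B ] → [ C ] ⊩ [ A ] → [ B ] ⊩ [ D ] →
                     NPremises C D A B
NPremises-of-equiv ac db ca bd =
  premises (⊩-mono₁ ∈₀ ∈₀ ac) (⊩-mono₁ ∈₁ ∈₀ db) (⊩-mono₁ ∈₀ ∈₀ ca) (⊩-mono₁ ∈₁ ∈₀ bd)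

⊩-id : (X : Fm) → [ X ] ⊩ [ X ]
⊩-id (atom p) = ⊩-ax
⊩-id ⊥'       = ⊩-⊥ˡ
⊩-id (A ∧' B) = ⊩-∧ˡ (⊩-∧ʳ (⊩-mono₁ ∈₀ ∈₀ (⊩-id A)) (⊩-mono₁ ∈₁ ∈₀ (⊩-id B)))
⊩-id (A ∨' B) = ⊩-∨ˡ (⊩-∨ʳ (⊩-mono₁ ∈₀ ∈₀ (⊩-id A))) (⊩-∨ʳ (⊩-mono₁ ∈₀ ∈₁ (⊩-id B)))
⊩-id (A ⇒ B)  = ⊩-⇒LR (NPremises-of-equiv (⊩-id A) (⊩-id B) (⊩-id A) (⊩-id B))

⊩-distrib : [ A ∧' (B ∨' C) ] ⊩ [ (A ∧' B) ∨' (A ∧' C) ]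
⊩-distrib {A} {B} {C} =
  ⊩-∧ˡ (⊩-mono (λ { ∈₀ → ∈₁ ; ∈₁ → ∈₀ }) id
    (⊩-∨ʳ (⊩-∨ˡ (⊩-mono id (xs⊆xs++ys _ _) (with-A B)) (⊩-weakenʳ (with-A C)))))
  where
    with-A : (X : Fm) → X ∷ A ∷ [] ⊩ [ A ∧' X ]
    with-A X = ⊩-∧ʳ (⊩-mono₁ ∈₁ ∈₀ (⊩-id A)) (⊩-mono₁ ∈₀ ∈₀ (⊩-id X))

⊩-⇔-of-NPremises : NPremises C D A B → [] ⊩ [ (A ⇒ B) ⇔' (C ⇒ D) ]
⊩-⇔-of-NPremises ps = ⊩-∧ʳ (⊩-⇒ʳ (⊩-⇒LR (NPremises-sym ps))) (⊩-⇒ʳ (⊩-⇒LR ps))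

⊢WFN⇒⊩ : ⊢WFN F → [] ⊩ [ F ]
≼⇒⊩ : X ≼ Y → [ X ] ⊩ [ Y ]

≼⇒⊩ h = ⊩-⇒ʳ⁻ (⊢WFN⇒⊩ h)

⊢WFN⇒⊩ ax∨₁        = ⊩-⇒ʳ (⊩-∨ʳ (⊩-mono₁ ∈₀ ∈₀ (⊩-id _)))
⊢WFN⇒⊩ ax∨₂        = ⊩-⇒ʳ (⊩-∨ʳ (⊩-mono₁ ∈₀ ∈₁ (⊩-id _)))
⊢WFN⇒⊩ ax∧₁        = ⊩-⇒ʳ (⊩-∧ˡ (⊩-mono₁ ∈₀ ∈₀ (⊩-id _)))
⊢WFN⇒⊩ ax∧₂        = ⊩-⇒ʳ (⊩-∧ˡ (⊩-mono₁ ∈₁ ∈₀ (⊩-id _)))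
⊢WFN⇒⊩ axDis       = ⊩-⇒ʳ ⊩-distrib
⊢WFN⇒⊩ axId        = ⊩-⇒ʳ (⊩-id _)
⊢WFN⇒⊩ ax⊥         = ⊩-⇒ʳ ⊩-⊥ˡ
⊢WFN⇒⊩ (mp h₁ h₂)  = ⊩-trans (⊢WFN⇒⊩ h₁) (≼⇒⊩ h₂)
⊢WFN⇒⊩ (wk h)      = ⊩-⇒ʳ (⊩-weakenˡ (⊢WFN⇒⊩ h))
⊢WFN⇒⊩ (tr h₁ h₂)  = ⊩-⇒ʳ (⊩-trans (≼⇒⊩ h₁) (≼⇒⊩ h₂))
⊢WFN⇒⊩ (∧I⇒ h₁ h₂) = ⊩-⇒ʳ (⊩-∧ʳ (≼⇒⊩ h₁) (≼⇒⊩ h₂))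
⊢WFN⇒⊩ (∨E⇒ h₁ h₂) = ⊩-⇒ʳ (⊩-∨ˡ (≼⇒⊩ h₁) (≼⇒⊩ h₂))
⊢WFN⇒⊩ (∧I h₁ h₂)  = ⊩-∧ʳ (⊢WFN⇒⊩ h₁) (⊢WFN⇒⊩ h₂)
⊢WFN⇒⊩ (cong⇒ h₁ h₂) =
  ⊩-⇔-of-NPremises (NPremises-of-equiv (to h₁) (from h₂) (from h₁) (to h₂))
  where
    to : ⊢WFN (X ⇔' Y) → [ X ] ⊩ [ Y ]
    to h = ⊩-⇒ʳ⁻ (⊩-∧ʳ⁻₁ (⊢WFN⇒⊩ h))
    from : ⊢WFN (X ⇔' Y) → [ Y ] ⊩ [ X ]
    from h = ⊩-⇒ʳ⁻ (⊩-∧ʳ⁻₂ (⊢WFN⇒⊩ h))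
⊢WFN⇒⊩ (ruleN h₁ h₂ h₃ h₄) = ⊩-⇔-of-NPremises (premises
  (⊩-mono id (⊆-reflexive-↭ (swap _ _ ↭-refl)) (⊩-∨ʳ⁻ (≼⇒⊩ h₁)))
  (⊩-∧ˡ⁻ (≼⇒⊩ h₃))
  (⊩-∨ʳ⁻ (≼⇒⊩ h₂))
  (⊩-∧ˡ⁻ (≼⇒⊩ h₄)))

⊩-⋀ : (Γ : List Fm) → Γ ⊩ [ ⋀ Γ ]
⊩-⋀ []          = ⊩-⇒ʳ ⊩-⊥ˡ
⊩-⋀ (A ∷ [])    = ⊩-id A
⊩-⋀ (A ∷ B ∷ Γ) = ⊩-∧ʳ (⊩-mono₁ ∈₀ ∈₀ (⊩-id A)) (⊩-weakenˡ (⊩-⋀ (B ∷ Γ)))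

⊩-⋁ : (Δ : List Fm) → [ ⋁ Δ ] ⊩ Δ
⊩-⋁ []          = ⊩-⊥ˡ
⊩-⋁ (A ∷ [])    = ⊩-id A
⊩-⋁ (A ∷ B ∷ Δ) = ⊩-∨ˡ (⊩-mono₁ ∈₀ ∈₀ (⊩-id A)) (⊩-weakenʳ (⊩-⋁ (B ∷ Δ)))

⊢G-permˡ : Γ ↭ Γ' → Γ ⊢G Δ → Γ' ⊢G Δ
⊢G-permˡ σ = perm σ ↭-refl

⊢G-permʳ : Δ ↭ Δ' → Γ ⊢G Δ → Γ ⊢G Δ'
⊢G-permʳ = perm ↭-refl

swap₀ : X ∷ Y ∷ Δ ↭ Y ∷ X ∷ Δ
swap₀ = swap _ _ ↭-refl

⊢G-weakenʳ : Γ ⊢G Δ → Γ ⊢G X ∷ Δ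
⊢G-weakenʳ (perm σ τ d)      = perm σ (prep _ τ) (⊢G-weakenʳ d)
⊢G-weakenʳ ax                = ⊢G-permʳ swap₀ ax
⊢G-weakenʳ ⊥L                = ⊥L
⊢G-weakenʳ (∧L d)            = ∧L (⊢G-weakenʳ d)
⊢G-weakenʳ (∧R d e)          =
  ⊢G-permʳ swap₀ (∧R (⊢G-permʳ swap₀ (⊢G-weakenʳ d)) (⊢G-permʳ swap₀ (⊢G-weakenʳ e)))
⊢G-weakenʳ (∨L d e)          = ∨L (⊢G-weakenʳ d) (⊢G-weakenʳ e)
⊢G-weakenʳ (∨R d)            =
  ⊢G-permʳ swap₀ (∨R (⊢G-permʳ (↭-trans swap₀ (prep _ swap₀)) (⊢G-weakenʳ d)))
⊢G-weakenʳ (⇒R d)            = ⊢G-permʳ swap₀ (⇒R d)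
⊢G-weakenʳ (⇒LRN d₁ d₂ d₃ d₄) = ⊢G-permʳ swap₀ (⇒LRN d₁ d₂ d₃ d₄)

⊢G-leftBranch : (X : Fm) → (∀ {l} → LeftBranch X l → l ++ Γ ⊢G Δ) → X ∷ Γ ⊢G Δ
⊢G-leftBranch (atom p) h = h atomˡ
⊢G-leftBranch ⊥'       h = ⊥L
⊢G-leftBranch (A ⇒ B)  h = h ⇒ˡ
⊢G-leftBranch (A ∨' B) h = ∨L (⊢G-leftBranch A (h ∘ ∨ˡ₁)) (⊢G-leftBranch B (h ∘ ∨ˡ₂))
⊢G-leftBranch {Γ = Γ} (A ∧' B) h =
  ∧L (⊢G-leftBranch A λ {l₁} a → ⊢G-permˡ (↭-sym (shift B l₁ Γ))
     (⊢G-leftBranch B λ {l₂} b → ⊢G-permˡ (↭-trans (↭-reflexive (++-assoc l₁ l₂ Γ)) (shifts l₁ l₂))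
       (h (∧ˡ a b))))

⊢G-rightBranch : (X : Fm) → (∀ {r} → RightBranch X r → Γ ⊢G r ++ Δ) → Γ ⊢G X ∷ Δ
⊢G-rightBranch (atom p) h = h atomʳ
⊢G-rightBranch ⊥'       h = ⊢G-weakenʳ (h ⊥ʳ)
⊢G-rightBranch (A ⇒ B)  h = h ⇒ʳ
⊢G-rightBranch (A ∧' B) h = ∧R (⊢G-rightBranch A (h ∘ ∧ʳ₁)) (⊢G-rightBranch B (h ∘ ∧ʳ₂))
⊢G-rightBranch {Δ = Δ} (A ∨' B) h =
  ∨R (⊢G-rightBranch A λ {r₁} a → ⊢G-permʳ (↭-sym (shift B r₁ Δ))
     (⊢G-rightBranch B λ {r₂} b → ⊢G-permʳ (↭-trans (↭-reflexive (++-assoc r₁ r₂ Δ)) (shifts r₁ r₂))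
       (h (∨ʳ a b))))

⊩⇒⊢G : Γ ⊩ Δ → Γ ⊢G Δ
Closed⇒⊢G : Closed l r → l ⊢G r

⊩⇒⊢G {Γ} {Δ} (byLeaves f) =
  Concat-elim ⊢G-permˡ (⊢G-leftBranch _) Γ λ ls →
  Concat-elim ⊢G-permʳ (⊢G-rightBranch _) Δ λ rs →
  Closed⇒⊢G (f ls rs)

Closed⇒⊢G (byAx m n) = perm (proj₂ (∈⇒↭-cons m)) (proj₂ (∈⇒↭-cons n)) ax
Closed⇒⊢G (by⇒R n d) = ⊢G-permʳ (proj₂ (∈⇒↭-cons n)) (⇒R (⊩⇒⊢G d))
Closed⇒⊢G (by⇒LR m n (premises d₁ d₂ d₃ d₄)) =
  perm (proj₂ (∈⇒↭-cons m)) (proj₂ (∈⇒↭-cons n)) (⇒LRN (⊩⇒⊢G d₁) (⊩⇒⊢G d₂) (⊩⇒⊢G d₃) (⊩⇒⊢G d₄))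

⊢WFN-complete : (Γ Δ : List Fm) → ⊢WFN (⋀ Γ ⇒ ⋁ Δ) → Γ ⊢G Δ
⊢WFN-complete Γ Δ h = ⊩⇒⊢G (⊩-trans (⊩-⋀ Γ) (⊩-trans (≼⇒⊩ h) (⊩-⋁ Δ)))

mainTheorem6 : (Γ Δ : List Fm) → ((Γ ⊢G Δ → ⊢WFN (⋀ Γ ⇒ ⋁ Δ)) × (⊢WFN (⋀ Γ ⇒ ⋁ Δ) → Γ ⊢G Δ))
mainTheorem6 Γ Δ = ⊢G-sound , ⊢WFN-complete Γ Δ
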